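{- Let $\mathcal{A}$ be a finite alphabet and let $s$ be a balanced standard episturmian sequence over $\mathcal{A}$ containing at least three distinct letters. Suppose a directive sequence of $s$ can be written as $\Delta(s)=x\,\alpha^{\ell}\,y$ with $x\in\mathcal{A}^+$ a nonempty finite word, $\alpha\in\mathcal{A}$, $\ell\ge 2$, $y\in\mathcal{A}^{\omega}$, where the letters of the word $x\alpha$ are pairwise distinct (so that $\alpha$ is the first repeated letter of $\Delta(s)$). Then no letter occurring in $x$ occurs in $y$, i.e. $x_i\neq y_j$ for all $i,j$.
   Context: For a finite word $w$, $w^{(+)}$ denotes its palindromic right closure, the shortest palindrome having $w$ as a prefix. For an infinite word $\Delta=x_1x_2\cdots$ over $\mathcal{A}$ set $u_1=\varepsilon$ and $u_{n+1}=(u_nx_n)^{(+)}$ for $n\ge1$; for a finite word $w=x_1\cdots x_n$ write $\mathrm{Pal}(w)=u_{n+1}$. An infinite word $s$ is standard episturmian if there exists an infinite word $\Delta$ (called a directive sequence of $s$) such that every $u_n$ is a prefix of $s$; one writes $s=\mathrm{Pal}(\Delta)$. A (finite or infinite) word is balanced if for any two factors $u,v$ of the same length and every letter $a$, $||u|_a-|v|_a|\le 1$, where $|u|_a$ is the number of occurrences of $a$ in $u$. The first repeated letter of $\Delta$ is $\Delta_j$ for the smallest $j$ such that $\Delta_j=\Delta_i$ for some $i<j$. -}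

module Defs where

open import Data.Nat using (ℕ; zero; suc; _+_; _≤_)
open import Data.Fin using (Fin)
open import Data.List using (List; []; _∷_; _++_; [_]; length; reverse)
open import Data.Product using (Σ; ∃; _×_; _,_)
open import Relation.Binary.PropositionalEquality using (_≡_; _≢_)
open import Relation.Nullary using (¬_)
open import Data.Bool using (if_then_else_)
open import Relation.Nullary.Decidable using (⌊_⌋)
import Data.Fin as F

-- Alphabet: the finite alphabet 𝒜 is Fin k.
-- Infinite words over A: functions ℕ → A (0-indexed).
Stream : Set → Set
Stream A = ℕ → A

_⊙_ : {A : Set} → List A → Stream A → Stream A
([] ⊙ y) n = y n
((a ∷ x) ⊙ y) zero = a
((a ∷ x) ⊙ y) (suc n) = (x ⊙ y) n

takeS : {A : Set} → ℕ → Stream A → List A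
takeS zero s = []
takeS (suc n) s = s 0 ∷ takeS n (λ m → s (suc m))

IsPrefixS : {A : Set} → List A → Stream A → Set
IsPrefixS w s = takeS (length w) s ≡ w

IsPrefix : {A : Set} → List A → List A → Set
IsPrefix w p = ∃ λ t → w ++ t ≡ p

IsPalindrome : {A : Set} → List A → Set
IsPalindrome p = reverse p ≡ p

IsPalClosure : {A : Set} → List A → List A → Set
IsPalClosure w p =
  IsPalindrome p × IsPrefix w p ×
  (∀ q → IsPalindrome q → IsPrefix w q → length p ≤ length q)

-- Δ is a directive sequence of s:  u₁ = ε, u_{n+1} = (u_n x_n)^(+),
-- every u_n is a prefix of s.  (Here u n stands for u_{n+1}, Δ n for x_{n+1}.)
IsDirectiveSeq : {A : Set} → Stream A → Stream A → Set
IsDirectiveSeq {A} Δ s = Σ (ℕ → List A) λ u →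
  (u 0 ≡ []) ×
  (∀ n → IsPalClosure (u n ++ [ Δ n ]) (u (suc n))) ×
  (∀ n → IsPrefixS (u n) s)

StandardEpisturmian : {A : Set} → Stream A → Set
StandardEpisturmian {A} s = Σ (Stream A) λ Δ → IsDirectiveSeq Δ s

count : {k : ℕ} → Stream (Fin k) → Fin k → ℕ → ℕ → ℕ
count s a i zero = 0
count s a i (suc n) =
  (if ⌊ s i F.≟ a ⌋ then 1 else 0) + count s a (suc i) n

Balanced : {k : ℕ} → Stream (Fin k) → Set
Balanced {k} s = ∀ (a : Fin k) (i j n : ℕ) →
  (count s a i n ≤ 1 + count s a j n) × (count s a j n ≤ 1 + count s a i n)

AtLeastThreeLetters : {A : Set} → Stream A → Set
AtLeastThreeLetters s = ∃ λ i → ∃ λ j → ∃ λ m →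
  (s i ≢ s j) × (s i ≢ s m) × (s j ≢ s m)

{-# OPTIONS --safe #-}
module Submission where

-- Write π = |u m| = |Pal(x)| with m = |x|, and c = π + 1. As α does not occur in Pal(x), every
-- further α of the directive sequence appends one period: Pal(x α^k) = (Pal(x) α)^k Pal(x).
-- Taking k = 2, the factor of length c + 1 starting at position π begins and ends with α, so by
-- balance every factor of length c + 1 contains an α. Such an α-free factor is found whenever the
-- closure step N (with Δ N ≠ α) reflects position |u N| + 1 into the last π letters of u N: the
-- factor consists of those π letters, Δ N, and the reflected letter.
-- If |x| = 1, s has a third letter; at its first occurrence Δ N we get u (N+1) = u N Δ N u N, which
-- reflects as required. If |x| ≥ 2 and β ≠ α ends a run α^n, the closure of (Pal(x) α)^n Pal(x) β
-- either reflects as required or makes Pal(x) β a palindrome; the latter forces Pal(x) = β^π,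
-- contradicting that x has two distinct letters. Hence y = α^ω.

open import Defs
open import Function using (_∘_)
open import Data.Nat using (ℕ; zero; suc; _+_; _*_; _∸_; _≤_; _<_; z≤n; s≤s; z<s; _≤?_; _<?_)
open import Data.Nat.Properties hiding (_≟_)
open import Data.Nat.DivMod using (_%_; _/_; m≡m%n+[m/n]*n; m%n<n)
open import Data.Nat.Tactic.RingSolver using (solve-∀)
open import Data.Fin using (Fin; _≟_)
open import Data.List using (List; []; _∷_; _++_; [_]; replicate; length; reverse)
open import Data.List.Properties using (∷-injective; reverse-++; ++-assoc; length-++; length-replicate)
open import Data.List.Membership.Propositional using (_∈_)
open import Data.List.Relation.Unary.Any using (here; there)
open import Data.List.Relation.Unary.All as All using (All)
open import Data.List.Relation.Unary.AllPairs using (_∷_)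
open import Data.List.Relation.Unary.Unique.Propositional using (Unique)
open import Data.Product using (∃; _×_; _,_; proj₁; proj₂)
open import Data.Sum using (_⊎_; inj₁; inj₂)
open import Data.Empty using (⊥; ⊥-elim)
open import Relation.Nullary using (¬_; Dec; yes; no)
open import Relation.Nullary.Decidable using (_×-dec_; ¬?; decidable-stable)
open import Relation.Binary.Definitions using (tri<; tri≈; tri>)
open import Relation.Binary.PropositionalEquality hiding ([_])

suc-+-assoc : ∀ a b c → suc (a + b + c) ≡ a + suc (b + c)
suc-+-assoc a b c = trans (cong suc (+-assoc a b c)) (sym (+-suc a (b + c)))

mirror-∸ : ∀ {i j n} → suc (i + j) ≡ n → n ∸ suc i ≡ j
mirror-∸ {i} {j} refl = m+n∸m≡n i j

m+n≡o+o⇒m≡n : ∀ {m n o} → m + n ≡ o + o → m ≤ o → n ≤ o → m ≡ n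
m+n≡o+o⇒m≡n {m} {n} m+n≡o+o m≤o n≤o =
  trans (m+n≡o+o⇒m≡o m+n≡o+o m≤o n≤o) (sym (m+n≡o+o⇒m≡o (trans (+-comm n m) m+n≡o+o) n≤o m≤o))
  where
    m+n≡o+o⇒m≡o : ∀ {a b o} → a + b ≡ o + o → a ≤ o → b ≤ o → a ≡ o
    m+n≡o+o⇒m≡o a+b≡o+o a≤o b≤o = ≤-antisym a≤o (≮⇒≥ λ a<o → <-irrefl a+b≡o+o (+-mono-<-≤ a<o b≤o))

least : {P : ℕ → Set} → (∀ n → Dec (P n)) → ∀ {n} → P n → ∃ λ m → P m × (∀ i → i < m → ¬ P i)
least {P} P? {n} Pn = search 0 n (λ _ ()) (subst P (sym (+-identityʳ n)) Pn)
  where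
    search : ∀ i d → (∀ j → j < i → ¬ P j) → P (d + i) → ∃ λ m → P m × (∀ j → j < m → ¬ P j)
    search i d below Pd+i with P? i
    ... | yes Pi = i , Pi , below
    search i zero    below Pi   | no ¬Pi = ⊥-elim (¬Pi Pi)
    search i (suc d) below Pd+i | no ¬Pi = search (suc i) d below′ (subst P (sym (+-suc d i)) Pd+i)
      where
        below′ : ∀ j → j < suc i → ¬ P j
        below′ j j<1+i with m<1+n⇒m<n∨m≡n j<1+i
        ... | inj₁ j<i  = below j j<i
        ... | inj₂ refl = ¬Pi

pigeonhole : ∀ {A : Set} {a b e₁ e₂ e₃ : A} → e₁ ≡ a ⊎ e₁ ≡ b → e₂ ≡ a ⊎ e₂ ≡ b → e₃ ≡ a ⊎ e₃ ≡ b →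
             e₁ ≢ e₂ → e₁ ≢ e₃ → e₂ ≢ e₃ → ⊥
pigeonhole (inj₁ refl) (inj₁ refl) _           e₁≢e₂ _     _     = e₁≢e₂ refl
pigeonhole (inj₂ refl) (inj₂ refl) _           e₁≢e₂ _     _     = e₁≢e₂ refl
pigeonhole (inj₁ refl) (inj₂ refl) (inj₁ refl) _     e₁≢e₃ _     = e₁≢e₃ refl
pigeonhole (inj₁ refl) (inj₂ refl) (inj₂ refl) _     _     e₂≢e₃ = e₂≢e₃ refl
pigeonhole (inj₂ refl) (inj₁ refl) (inj₁ refl) _     _     e₂≢e₃ = e₂≢e₃ refl
pigeonhole (inj₂ refl) (inj₁ refl) (inj₂ refl) _     e₁≢e₃ _     = e₁≢e₃ refl

outside-two : ∀ {k} {s : Stream (Fin k)} → AtLeastThreeLetters s → ∀ a b → ∃ λ t → s t ≢ a × s t ≢ b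
outside-two {s = s} (i , j , l , i≢j , i≢l , j≢l) a b
  with classify (s i) | classify (s j) | classify (s l)
  where
    classify : ∀ e → (e ≡ a ⊎ e ≡ b) ⊎ (e ≢ a × e ≢ b)
    classify e with e ≟ a | e ≟ b
    ... | yes e≡a | _       = inj₁ (inj₁ e≡a)
    ... | no _    | yes e≡b = inj₁ (inj₂ e≡b)
    ... | no e≢a  | no e≢b  = inj₂ (e≢a , e≢b)
... | inj₂ out | _        | _        = i , out
... | inj₁ _   | inj₂ out | _        = j , out
... | inj₁ _   | inj₁ _   | inj₂ out = l , out
... | inj₁ ci  | inj₁ cj  | inj₁ cl  = ⊥-elim (pigeonhole ci cj cl i≢j i≢l j≢l)

module _ {A : Set} where

  unique-snoc-∉ : ∀ {w : List A} {a b} → Unique (w ++ [ a ]) → b ∈ w → b ≢ a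
  unique-snoc-∉ {w = c ∷ w} (c≢ ∷ _)    (here refl) = last c≢
    where
      last : ∀ {P : A → Set} {v a} → All P (v ++ [ a ]) → P a
      last {v = []}    (p All.∷ _)  = p
      last {v = _ ∷ v} (_ All.∷ ps) = last {v = v} ps
  unique-snoc-∉ {w = c ∷ w} (_ ∷ uniq) (there b∈w) = unique-snoc-∉ uniq b∈w

  ⊙-++ : ∀ (w v : List A) z n → ((w ++ v) ⊙ z) n ≡ (w ⊙ (v ⊙ z)) n
  ⊙-++ []      v z n       = refl
  ⊙-++ (a ∷ w) v z zero    = refl
  ⊙-++ (a ∷ w) v z (suc n) = ⊙-++ w v z n

  ⊙-length-+ : ∀ (w : List A) z n → (w ⊙ z) (length w + n) ≡ z n
  ⊙-length-+ []      z n = refl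
  ⊙-length-+ (a ∷ w) z n = ⊙-length-+ w z n

  ⊙-∈ : ∀ (w : List A) z {n} → n < length w → (w ⊙ z) n ∈ w
  ⊙-∈ (a ∷ w) z {zero}  _         = here refl
  ⊙-∈ (a ∷ w) z {suc n} (s≤s n<w) = there (⊙-∈ w z n<w)

  replicate-⊙ : ∀ ℓ (a : A) z {n} → n < ℓ → (replicate ℓ a ⊙ z) n ≡ a
  replicate-⊙ (suc ℓ) a z {zero}  _         = refl
  replicate-⊙ (suc ℓ) a z {suc n} (s≤s n<ℓ) = replicate-⊙ ℓ a z n<ℓ

  length-takeS : ∀ n (f : Stream A) → length (takeS n f) ≡ n
  length-takeS zero    f = refl
  length-takeS (suc n) f = cong suc (length-takeS n (f ∘ suc))

  takeS-cong : ∀ n {f g : Stream A} → (∀ t → t < n → f t ≡ g t) → takeS n f ≡ takeS n g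
  takeS-cong zero    f≗g = refl
  takeS-cong (suc n) f≗g = cong₂ _∷_ (f≗g 0 z<s) (takeS-cong n (λ t t<n → f≗g (suc t) (s≤s t<n)))

  takeS-≡⇒agree : ∀ n {f g : Stream A} → takeS n f ≡ takeS n g → ∀ t → t < n → f t ≡ g t
  takeS-≡⇒agree (suc n) eq zero    _         = proj₁ (∷-injective eq)
  takeS-≡⇒agree (suc n) eq (suc t) (s≤s t<n) = takeS-≡⇒agree n (proj₂ (∷-injective eq)) t t<n

  takeS-≡-++-∷ : ∀ n (f : Stream A) w b r → takeS n f ≡ w ++ b ∷ r → f (length w) ≡ b
  takeS-≡-++-∷ (suc n) f []      b r eq = proj₁ (∷-injective eq)
  takeS-≡-++-∷ (suc n) f (_ ∷ w) b r eq = takeS-≡-++-∷ n (f ∘ suc) w b r (proj₂ (∷-injective eq))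

  takeS-snoc : ∀ n (f : Stream A) → takeS (suc n) f ≡ takeS n f ++ [ f n ]
  takeS-snoc zero    f = refl
  takeS-snoc (suc n) f = cong (f 0 ∷_) (takeS-snoc n (f ∘ suc))

  takeS-+ : ∀ m n (f : Stream A) → takeS (m + n) f ≡ takeS m f ++ takeS n (λ t → f (m + t))
  takeS-+ zero    n f = refl
  takeS-+ (suc m) n f = cong (f 0 ∷_) (takeS-+ m n (f ∘ suc))

  reverse-takeS : ∀ n (f : Stream A) → reverse (takeS n f) ≡ takeS n (λ t → f (n ∸ suc t))
  reverse-takeS zero    f = refl
  reverse-takeS (suc n) f = begin
    reverse (takeS (suc n) f)              ≡⟨ cong reverse (takeS-snoc n f) ⟩
    reverse (takeS n f ++ [ f n ])         ≡⟨ reverse-++ (takeS n f) [ f n ] ⟩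
    f n ∷ reverse (takeS n f)              ≡⟨ cong (f n ∷_) (reverse-takeS n f) ⟩
    f n ∷ takeS n (λ t → f (n ∸ suc t))    ∎
    where open ≡-Reasoning

-- Palindromic and periodic prefixes

PalindromeBelow : {A : Set} → ℕ → Stream A → Set
PalindromeBelow n f = ∀ i j → suc (i + j) ≡ n → f i ≡ f j

PeriodicBelow : {A : Set} → ℕ → ℕ → Stream A → Set
PeriodicBelow c n f = ∀ t → c + t < n → f (c + t) ≡ f t

module _ {A : Set} {n : ℕ} {f : Stream A} where

  palindrome-takeS : PalindromeBelow n f → IsPalindrome (takeS n f)
  palindrome-takeS palin = trans (reverse-takeS n f) (takeS-cong n reflect)
    where
      reflect : ∀ t → t < n → f (n ∸ suc t) ≡ f t
      reflect t t<n with m≤n⇒∃[o]m+o≡n t<n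
      ... | j , e = trans (cong f (mirror-∸ e)) (palin j t (trans (cong suc (+-comm j t)) e))

  palindrome-takeS⁻ : IsPalindrome (takeS n f) → PalindromeBelow n f
  palindrome-takeS⁻ palin i j e = sym (trans (cong f (sym (mirror-∸ e))) reflect)
    where
      reflect : f (n ∸ suc i) ≡ f i
      reflect = takeS-≡⇒agree n (trans (sym (reverse-takeS n f)) palin) i (subst (i <_) e (s≤s (m≤m+n i j)))

nested-palindromes-constant : ∀ {A : Set} {p} {g : Stream A} →
  PalindromeBelow p g → PalindromeBelow (suc p) g → ∀ t → t ≤ p → g t ≡ g 0
nested-palindromes-constant inner outer zero    _   = refl
nested-palindromes-constant inner outer (suc t) t<p with m≤n⇒∃[o]m+o≡n t<p
... | w , e = trans (outer (suc t) w (cong suc e))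
                (trans (inner w t (trans (cong suc (+-comm w t)) e))
                       (nested-palindromes-constant inner outer t (<⇒≤ t<p)))

-- Prefixes of (w a)^ω, where w = f 0 ⋯ f (π - 1) is a palindrome.
module PalindromicPeriod {A : Set} (f : Stream A) {π : ℕ} (palin : PalindromeBelow π f) where

  c : ℕ
  c = suc π

  module _ {n : ℕ} (periodic : PeriodicBelow c n f) where

    shift : ∀ q t → q * c + t < n → f (q * c + t) ≡ f t
    shift zero    t _  = refl
    shift (suc q) t lt = trans (cong f (+-assoc c (q * c) t)) (trans (periodic _ lt′) (shift q t lt″))
      where
        lt′ : c + (q * c + t) < n
        lt′ = subst (_< n) (+-assoc c (q * c) t) lt
        lt″ : q * c + t < n
        lt″ = ≤-<-trans (m≤n+m (q * c + t) c) lt′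

    mirror : ∀ q i j → suc (i + j) ≡ q * c + π → i < n → j < n → f i ≡ f j
    private
      mirror-long : ∀ q i j → suc (i + j) ≡ q * c + π → i < n → j < n → c ≤ i → f i ≡ f j
      mirror-short : ∀ q i j → suc (i + j) ≡ q * c + π → i ≤ π → j ≤ π → f i ≡ f j

    mirror q i j e i<n j<n with c ≤? i | c ≤? j
    ... | yes c≤i | _       = mirror-long q i j e i<n j<n c≤i
    ... | no _    | yes c≤j = sym (mirror-long q j i (trans (cong suc (+-comm j i)) e) j<n i<n c≤j)
    ... | no c≰i  | no c≰j  = mirror-short q i j e (≤-pred (≰⇒> c≰i)) (≤-pred (≰⇒> c≰j))

    mirror-long q i j e i<n j<n c≤i with m≤n⇒∃[o]m+o≡n c≤i
    mirror-long zero    _ j e _   _   _ | i , refl =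
      ⊥-elim (<-irrefl (sym e) (s≤s (≤-trans (n≤1+n π) (≤-trans (m≤m+n c i) (m≤m+n (c + i) j)))))
    mirror-long (suc q) _ j e i<n j<n _ | i , refl =
      trans (periodic i i<n) (mirror q i j e′ (≤-<-trans (m≤n+m i c) i<n) j<n)
      where
        e′ : suc (i + j) ≡ q * c + π
        e′ = +-cancelˡ-≡ c _ _ (trans (sym (suc-+-assoc c i j)) (trans e (+-assoc c (q * c) π)))

    mirror-short zero          i j e _   _   = palin i j e
    mirror-short (suc zero)    i j e i≤π j≤π =
      cong f (m+n≡o+o⇒m≡n (suc-injective (trans e (cong (_+ π) (+-identityʳ c)))) i≤π j≤π)
    mirror-short (suc (suc q)) i j e i≤π j≤π = ⊥-elim (<-irrefl e (begin-strict
      suc (i + j)                              <⟨ s≤s (s≤s (+-mono-≤ i≤π j≤π)) ⟩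
      suc (suc (π + π))                        ≤⟨ m≤m+n _ (q * c + π) ⟩
      suc (suc (π + π)) + (q * c + π)          ≡⟨ expand π q ⟩
      suc (suc q) * c + π                      ∎))
      where
        open ≤-Reasoning
        expand : ∀ π q → suc (suc (π + π)) + (q * suc π + π) ≡ suc (suc q) * suc π + π
        expand = solve-∀

    occurrence : ∀ {a} → (∀ t → t < π → f t ≢ a) → ∀ t → t < n → f t ≡ a → ∃ λ q → t ≡ q * c + π
    occurrence {a} a∉w t t<n ft≡a = t / c , trans t≡ (cong (t / c * c +_) r≡π)
      where
        r = t % c
        t≡ : t ≡ t / c * c + r
        t≡ = trans (m≡m%n+[m/n]*n t c) (+-comm r (t / c * c))
        fr≡a : f r ≡ a
        fr≡a = trans (sym (shift (t / c) r (subst (_< n) t≡ t<n))) (trans (cong f (sym t≡)) ft≡a)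
        r≡π : r ≡ π
        r≡π = ≤-antisym (≤-pred (m%n<n t c)) (≮⇒≥ λ r<π → a∉w r r<π fr≡a)

-- Palindromic prefixes of a standard episturmian word

module DirectiveSequence {A : Set} {Δ s : Stream A} (dir : IsDirectiveSeq Δ s) where

  u : ℕ → List A
  u = proj₁ dir

  L : ℕ → ℕ
  L n = length (u n)

  private
    u₀≡[] : u 0 ≡ []
    u₀≡[] = proj₁ (proj₂ dir)

    closure : ∀ n → IsPalClosure (u n ++ [ Δ n ]) (u (suc n))
    closure = proj₁ (proj₂ (proj₂ dir))

    u-prefix : ∀ n → IsPrefixS (u n) s
    u-prefix = proj₂ (proj₂ (proj₂ dir))

  L₀≡0 : L 0 ≡ 0
  L₀≡0 = cong length u₀≡[]

  u-palindrome : ∀ n → IsPalindrome (u n)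
  u-palindrome zero    = subst IsPalindrome (sym u₀≡[]) refl
  u-palindrome (suc n) = proj₁ (closure n)

  s-palindrome : ∀ n → PalindromeBelow (L n) s
  s-palindrome n = palindrome-takeS⁻ (subst IsPalindrome (sym (u-prefix n)) (u-palindrome n))

  u-Δ-prefix : ∀ n → ∃ λ r → takeS (L (suc n)) s ≡ u n ++ Δ n ∷ r
  u-Δ-prefix n with proj₁ (proj₂ (closure n))
  ... | r , e = r , trans (u-prefix (suc n)) (trans (sym e) (++-assoc (u n) [ Δ n ] r))

  s-L≡Δ : ∀ n → s (L n) ≡ Δ n
  s-L≡Δ n with u-Δ-prefix n
  ... | r , e = takeS-≡-++-∷ (L (suc n)) s (u n) (Δ n) r e

  L<L-suc : ∀ n → L n < L (suc n)
  L<L-suc n with u-Δ-prefix n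
  ... | r , e = begin-strict
    L n                            <⟨ m<m+n (L n) z<s ⟩
    L n + length (Δ n ∷ r)         ≡⟨ length-++ (u n) ⟨
    length (u n ++ Δ n ∷ r)        ≡⟨ cong length e ⟨
    length (takeS (L (suc n)) s)   ≡⟨ length-takeS (L (suc n)) s ⟩
    L (suc n)                      ∎
    where open ≤-Reasoning

  L-mono : ∀ {m n} → m ≤ n → L m ≤ L n
  L-mono {m} m≤n with m≤n⇒∃[o]m+o≡n m≤n
  ... | o , refl = subst (λ p → L m ≤ L p) (+-comm o m) (L-mono-+ o)
    where
      L-mono-+ : ∀ o → L m ≤ L (o + m)
      L-mono-+ zero    = ≤-refl
      L-mono-+ (suc o) = ≤-trans (L-mono-+ o) (<⇒≤ (L<L-suc (o + m)))

  n≤L : ∀ n → n ≤ L n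
  n≤L zero    = z≤n
  n≤L (suc n) = ≤-trans (s≤s (n≤L n)) (L<L-suc n)

  -- Minimality of the closure, tested against the palindrome of length M obtained by
  -- reflecting s 0 ⋯ s (L n).
  L-suc≤ : ∀ n M → L n < M → M ≤ suc (L n) + suc (L n) →
           (∀ i j → suc (i + j) ≡ M → i ≤ L n → j ≤ L n → s i ≡ s j) → L (suc n) ≤ M
  L-suc≤ n M Ln<M M≤ s-sym =
    subst (L (suc n) ≤_) (length-takeS M w) (proj₂ (proj₂ (closure n)) (takeS M w) w-palindrome w-prefix)
    where
      w : Stream A
      w t with t ≤? L n
      ... | yes _ = s t
      ... | no _  = s (M ∸ suc t)

      w-low : ∀ t → t ≤ L n → w t ≡ s t
      w-low t t≤ with t ≤? L n
      ... | yes _ = refl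
      ... | no t≰ = ⊥-elim (t≰ t≤)

      w-high : ∀ t → L n < t → w t ≡ s (M ∸ suc t)
      w-high t Ln<t with t ≤? L n
      ... | yes t≤ = ⊥-elim (<⇒≱ Ln<t t≤)
      ... | no _   = refl

      w-sym : PalindromeBelow M w
      w-sym i j e with ≤-<-connex i (L n) | ≤-<-connex j (L n)
      ... | inj₁ i≤ | inj₁ j≤ = trans (w-low i i≤) (trans (s-sym i j e i≤ j≤) (sym (w-low j j≤)))
      ... | inj₁ i≤ | inj₂ j> =
        trans (w-low i i≤) (trans (cong s (sym (mirror-∸ (trans (cong suc (+-comm j i)) e)))) (sym (w-high j j>)))
      ... | inj₂ i> | inj₁ j≤ = trans (w-high i i>) (trans (cong s (mirror-∸ e)) (sym (w-low j j≤)))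
      ... | inj₂ i> | inj₂ j> = ⊥-elim (<-irrefl (sym e) (s≤s (≤-trans M≤ (+-mono-≤ i> j>))))

      w-palindrome : IsPalindrome (takeS M w)
      w-palindrome = palindrome-takeS w-sym

      rest : List A
      rest = takeS (M ∸ suc (L n)) (λ t → w (suc (L n) + t))

      w-prefix : IsPrefix (u n ++ [ Δ n ]) (takeS M w)
      w-prefix = rest , sym (begin
        takeS M w                                ≡⟨ cong (λ z → takeS z w) (m+[n∸m]≡n Ln<M) ⟨
        takeS (suc (L n) + (M ∸ suc (L n))) w    ≡⟨ takeS-+ (suc (L n)) _ w ⟩
        takeS (suc (L n)) w ++ rest              ≡⟨ cong (_++ rest) (takeS-cong (suc (L n)) (λ t → w-low t ∘ ≤-pred)) ⟩
        takeS (suc (L n)) s ++ rest              ≡⟨ cong (_++ rest) (takeS-snoc (L n) s) ⟩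
        (takeS (L n) s ++ [ s (L n) ]) ++ rest   ≡⟨ cong₂ (λ p a → (p ++ [ a ]) ++ rest) (u-prefix n) (s-L≡Δ n) ⟩
        (u n ++ [ Δ n ]) ++ rest                 ∎)
        where open ≡-Reasoning

  L-suc≤2L+1 : ∀ n → L (suc n) ≤ suc (L n + L n)
  L-suc≤2L+1 n = L-suc≤ n _ (s≤s (m≤m+n (L n) (L n))) (s≤s (+-monoʳ-≤ (L n) (n≤1+n (L n))))
                   (λ i j e i≤ j≤ → cong s (m+n≡o+o⇒m≡n (suc-injective e) i≤ j≤))

  tail≤L : ∀ n d → suc (L n + d) ≡ L (suc n) → d ≤ L n
  tail≤L n d e = +-cancelˡ-≤ (L n) d (L n) (≤-pred (subst (_≤ suc (L n + L n)) (sym e) (L-suc≤2L+1 n)))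

  s-from-Δ : ∀ n t → t < L n → ∃ λ r → r < n × s t ≡ Δ r
  s-from-Δ zero    t t<L = ⊥-elim (n≮0 (subst (t <_) L₀≡0 t<L))
  s-from-Δ (suc n) t t<L with <-cmp t (L n)
  ... | tri< t<Ln _ _ = let (r , r<n , e) = s-from-Δ n t t<Ln in r , m<n⇒m<1+n r<n , e
  ... | tri≈ _ refl _ = n , ≤-refl , s-L≡Δ n
  ... | tri> _ _ Ln<t with m≤n⇒∃[o]m+o≡n t<L
  ...   | j , e = let (r , r<n , e′) = s-from-Δ n j j<Ln in
                  r , m<n⇒m<1+n r<n , trans (s-palindrome (suc n) t j e) e′
    where
      j<Ln : j < L n
      j<Ln = +-cancelˡ-< (L n) j (L n) (<-≤-trans (+-monoˡ-< j Ln<t)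
               (≤-pred (subst (_≤ suc (L n + L n)) (sym e) (L-suc≤2L+1 n))))

  module Run (m : ℕ) {α : A} (α∉u : ∀ t → t < L m → s t ≢ α) (Δm≡α : Δ m ≡ α) where

    π : ℕ
    π = L m

    open PalindromicPeriod s (s-palindrome m) public

    sπ≡α : s π ≡ α
    sπ≡α = trans (s-L≡Δ m) Δm≡α

    α-at : ∀ {n} → PeriodicBelow c n s → ∀ q → q * c + π < n → s (q * c + π) ≡ α
    α-at per q lt = trans (shift per q π lt) sπ≡α

    α-period-before : ∀ {n} → PeriodicBelow c n s → ∀ q t → c + t ≡ q * c + π → t < n → s t ≡ α
    α-period-before per zero    t e _   = ⊥-elim (<-irrefl (sym e) (s≤s (m≤m+n π t)))
    α-period-before per (suc q) t e t<n = subst (λ p → s p ≡ α) (sym t≡) (α-at per q (subst (_< _) t≡ t<n))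
      where
        t≡ : t ≡ q * c + π
        t≡ = +-cancelˡ-≡ c _ _ (trans e (+-assoc c (q * c) π))

    -- u (k + m) = (u m α)^k u m, recorded by its length and its period c
    RunShape : ℕ → Set
    RunShape k = L (k + m) ≡ k * c + π × PeriodicBelow c (L (k + m)) s

    run-step : ∀ k → Δ (k + m) ≡ α → RunShape k → RunShape (suc k)
    run-step k Δ≡α (Lk≡ , per) = L′≡ , subst (λ n → PeriodicBelow c n s) (sym L′≡c+Lk) per′
      where
        Lk = L (k + m)
        L′ = L (suc k + m)

        per⁺ : PeriodicBelow c (suc Lk) s
        per⁺ t lt with m<1+n⇒m<n∨m≡n lt
        ... | inj₁ lt′ = per t lt′
        ... | inj₂ e   = trans (cong s e) (trans (s-L≡Δ (k + m)) (trans Δ≡α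
                           (sym (α-period-before per k t (trans e Lk≡) (subst (t <_) e (s≤s (m≤n+m t π)))))))

        upper : L′ ≤ c + Lk
        upper = L-suc≤ (k + m) (c + Lk) (m<n+m Lk z<s)
                  (≤-trans (+-monoʳ-≤ c (n≤1+n Lk)) (+-monoˡ-≤ (suc Lk) (s≤s (L-mono (m≤n+m m k)))))
                  (λ i j e i≤ j≤ → mirror per⁺ (suc k) i j (trans e c+Lk≡) (s≤s i≤) (s≤s j≤))
          where
            c+Lk≡ : c + Lk ≡ suc k * c + π
            c+Lk≡ = trans (cong (c +_) Lk≡) (sym (+-assoc c (k * c) π))

        -- the reflection j of the α at position π lies in the periodic part, so j = q c + π
        lower : c + Lk ≤ L′
        lower with m≤n⇒∃[o]m+o≡n (<-≤-trans (s≤s (L-mono (m≤n+m m k))) (L<L-suc (k + m)))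
        ... | j , e with occurrence per⁺ α∉u j j<1+Lk (trans (sym (s-palindrome (suc k + m) π j e)) sπ≡α)
          where
            j<1+Lk : j < suc Lk
            j<1+Lk = s≤s (+-cancelˡ-≤ π j Lk (≤-pred (≤-trans (≤-reflexive e) upper)))
        ... | q , refl =
          subst (c + Lk ≤_) e (+-monoʳ-≤ c (subst (_≤ q * c + π) (sym Lk≡) (+-monoˡ-≤ π (*-monoˡ-≤ c k≤q))))
          where
            L′≡q : L′ ≡ suc q * c + π
            L′≡q = trans (sym e) (sym (+-assoc c (q * c) π))
            k≤q : k ≤ q
            k≤q = ≤-pred (*-cancelʳ-< c k (suc q) (+-cancelʳ-< π _ _
                    (subst (_< suc q * c + π) Lk≡ (<-≤-trans (L<L-suc (k + m)) (≤-reflexive L′≡q)))))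

        L′≡c+Lk : L′ ≡ c + Lk
        L′≡c+Lk = ≤-antisym upper lower

        L′≡ : L′ ≡ suc k * c + π
        L′≡ = trans L′≡c+Lk (trans (cong (c +_) Lk≡) (sym (+-assoc c (k * c) π)))

        -- both c + t and t reflect onto the same j: the first in u (suc k + m), the second in
        -- the periodic extension of u (k + m)
        per′ : PeriodicBelow c (c + Lk) s
        per′ t lt with +-cancelˡ-< c t Lk lt
        ... | t<Lk with m≤n⇒∃[o]m+o≡n t<Lk
        ... | j , e =
          trans (s-palindrome (suc k + m) (c + t) j (trans (suc-+-assoc c t j) (trans (cong (c +_) e) (sym L′≡c+Lk))))
                (sym (mirror per⁺ k t j (trans e Lk≡) (m<n⇒m<1+n t<Lk) (m<n⇒m<1+n j<Lk)))
          where
            j<Lk : j < Lk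
            j<Lk = subst (j <_) e (s≤s (m≤n+m j t))

    run : ∀ n → (∀ k → k < n → Δ (k + m) ≡ α) → RunShape n
    run zero    _   = refl , λ t c+t<π → ⊥-elim (<-irrefl refl (<-trans c+t<π (s≤s (m≤m+n π t))))
    run (suc n) Δ≡α = run-step n (Δ≡α n ≤-refl) (run n (λ k k<n → Δ≡α k (m<n⇒m<1+n k<n)))

-- Balance

module _ {k : ℕ} (s : Stream (Fin k)) (a : Fin k) where

  count≡0 : ∀ i n → (∀ t → t < n → s (i + t) ≢ a) → count s a i n ≡ 0
  count≡0 i zero    _     = refl
  count≡0 i (suc n) avoid with s i ≟ a
  ... | yes si≡a = ⊥-elim (avoid 0 z<s (trans (cong s (+-identityʳ i)) si≡a))
  ... | no _     = count≡0 (suc i) n (λ t t<n → avoid (suc t) (s≤s t<n) ∘ trans (cong s (+-suc i t)))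

  count≥1 : ∀ i n t → t < n → s (i + t) ≡ a → 1 ≤ count s a i n
  count≥1 i (suc n) zero    _         e with s i ≟ a
  ... | yes _   = s≤s z≤n
  ... | no si≢a = ⊥-elim (si≢a (trans (cong s (sym (+-identityʳ i))) e))
  count≥1 i (suc n) (suc t) (s≤s t<n) e =
    ≤-trans (count≥1 (suc i) n t t<n (trans (cong s (sym (+-suc i t))) e)) (m≤n+m _ _)

  count≥2 : ∀ i l → s i ≡ a → s (i + suc l) ≡ a → 2 ≤ count s a i (suc (suc l))
  count≥2 i l si≡a e with s i ≟ a
  ... | yes _   = s≤s (count≥1 (suc i) (suc l) l ≤-refl (trans (cong s (sym (+-suc i l))) e))
  ... | no si≢a = ⊥-elim (si≢a si≡a)

  balanced⇒¬avoids : Balanced s → ∀ {i n} → 2 ≤ count s a i n → ∀ j → ¬ (∀ t → t < n → s (j + t) ≢ a)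
  balanced⇒¬avoids bal {i} {n} two j avoid =
    1+n≰n (≤-trans two (≤-trans (proj₁ (bal a i j n)) (≤-reflexive (cong suc (count≡0 j n avoid)))))

module BalancedSquare {k : ℕ} {Δ s : Stream (Fin k)} (dir : IsDirectiveSeq Δ s) (bal : Balanced s)
  (m : ℕ) {α : Fin k} (α∉u : ∀ t → t < DirectiveSequence.L dir m → s t ≢ α)
  (Δm≡α : Δ m ≡ α) (Δ1+m≡α : Δ (suc m) ≡ α) where

  open DirectiveSequence dir
  open Run m α∉u Δm≡α

  α-free-window-⊥ : ∀ g → ¬ (∀ t → t < suc c → s (g + t) ≢ α)
  α-free-window-⊥ = balanced⇒¬avoids s α bal (count≥2 s α π π sπ≡α sπ+c≡α)
    where
      square : RunShape 2
      square = run 2 λ { zero _ → Δm≡α ; (suc zero) _ → Δ1+m≡α ; (suc (suc _)) (s≤s (s≤s ())) }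

      sπ+c≡α : s (π + c) ≡ α
      sπ+c≡α = trans (cong s (trans (+-comm π c) (cong (_+ π) (sym (+-identityʳ c)))))
                 (α-at (proj₂ square) 1 (subst (1 * c + π <_) (sym (proj₁ square))
                   (+-monoˡ-< π (*-monoˡ-< c {1} {2} (s≤s (s≤s z≤n))))))

  suffix-α-free : ∀ N p → p < L N → L N ≤ p + π → s p ≢ α
  suffix-α-free N p p<LN LN≤p+π with m≤n⇒∃[o]m+o≡n p<LN
  ... | j , e = λ sp≡α → α∉u j j<π (trans (sym (s-palindrome N p j e)) sp≡α)
    where
      j<π : j < π
      j<π = +-cancelˡ-≤ p _ _ (≤-trans (≤-reflexive (trans (+-suc p j) e)) LN≤p+π)

  -- The window is the last π letters of u N, then Δ N, then s (L N + 1) = s (d - 1).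
  reflection-⊥ : ∀ N d → π ≤ L N → suc (L N + d) ≡ L (suc N) → L N < d + π → Δ N ≢ α → ⊥
  reflection-⊥ N zero    π≤LN _ LN<π _    = <⇒≱ LN<π π≤LN
  reflection-⊥ N (suc d) π≤LN e LN<d+π ΔN≢α with m≤n⇒∃[o]m+o≡n π≤LN
  ... | g , π+g≡LN = α-free-window-⊥ g window
    where
      g+π≡LN : g + π ≡ L N
      g+π≡LN = trans (+-comm g π) π+g≡LN

      window : ∀ t → t < suc c → s (g + t) ≢ α
      window t t<2+π with <-cmp t π
      ... | tri< t<π _ _ = suffix-α-free N (g + t) (subst (g + t <_) g+π≡LN (+-monoʳ-< g t<π))
                             (≤-trans (≤-reflexive (sym g+π≡LN)) (+-monoˡ-≤ π (m≤m+n g t)))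
      ... | tri≈ _ refl _ = λ sLN≡α → ΔN≢α (trans (sym (s-L≡Δ N)) (trans (cong s (sym g+π≡LN)) sLN≡α))
      ... | tri> _ _ π<t with ≤-antisym (≤-pred t<2+π) π<t
      ...   | refl = λ sLN+1≡α → suffix-α-free N d (tail≤L N (suc d) e) (≤-pred LN<d+π) (begin
        s d                ≡⟨ s-palindrome (suc N) (suc (L N)) d (trans (cong suc (sym (+-suc (L N) d))) e) ⟨
        s (suc (L N))      ≡⟨ cong s (trans (cong suc (sym g+π≡LN)) (sym (+-suc g π))) ⟩
        s (g + suc π)      ≡⟨ sLN+1≡α ⟩
        α                  ∎)
        where open ≡-Reasoning

  new-letter-⊥ : ∀ N → m ≤ N → 1 ≤ m → Δ N ≢ α → (∀ t → t < L N → s t ≢ Δ N) → ⊥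
  new-letter-⊥ N m≤N 1≤m ΔN≢α fresh with m≤n⇒∃[o]m+o≡n (L<L-suc N)
  ... | d , e = reflection-⊥ N d (L-mono m≤N) e (subst (λ x → L N < x + π) (sym d≡LN) (m<m+n (L N) 1≤π)) ΔN≢α
    where
      1≤π : 1 ≤ π
      1≤π = ≤-trans 1≤m (n≤L m)

      d≡LN : d ≡ L N
      d≡LN = ≤-antisym (tail≤L N d e)
               (≮⇒≥ λ d<LN → fresh d d<LN (trans (sym (s-palindrome (suc N) (L N) d e)) (s-L≡Δ N)))

  -- u (suc N) = u N · Δ N · reverse (s 0 ⋯ s (d - 1))
  module RunEnd (n : ℕ) (Δ≡α : ∀ i → i < suc n → Δ (i + m) ≡ α) where

    N K : ℕ
    N = suc n + m
    K = suc n * c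

    LN≡ : L N ≡ K + π
    LN≡ = proj₁ (run (suc n) Δ≡α)

    periodic : PeriodicBelow c (L N) s
    periodic = proj₂ (run (suc n) Δ≡α)

    d : ℕ
    d = proj₁ (m≤n⇒∃[o]m+o≡n (L<L-suc N))

    LN+d : suc (L N + d) ≡ L (suc N)
    LN+d = proj₂ (m≤n⇒∃[o]m+o≡n (L<L-suc N))

    sLN≡sd : s (L N) ≡ s d
    sLN≡sd = s-palindrome (suc N) (L N) d LN+d

    -- if d < K, c + d reflects onto the α at n c + π, while periodicity gives s (c + d) = s d = Δ N
    K≤d : Δ N ≢ α → K ≤ d
    K≤d ΔN≢α = ≮⇒≥ λ d<K → ΔN≢α (trans (sym (s-L≡Δ N)) (trans sLN≡sd (sd≡α d<K)))
      where
        sd≡α : d < K → s d ≡ α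
        sd≡α d<K = trans (sym sc+d≡sd) sc+d≡α
          where
            c+d≤LN : c + d ≤ L N
            c+d≤LN = begin
              c + d     ≡⟨ +-suc π d ⟨
              π + suc d ≤⟨ +-monoʳ-≤ π d<K ⟩
              π + K     ≡⟨ trans (+-comm π K) (sym LN≡) ⟩
              L N       ∎
              where open ≤-Reasoning

            sc+d≡sd : s (c + d) ≡ s d
            sc+d≡sd with m≤n⇒m<n∨m≡n c+d≤LN
            ... | inj₁ c+d<LN = periodic d c+d<LN
            ... | inj₂ c+d≡LN = trans (cong s c+d≡LN) sLN≡sd

            sc+d≡α : s (c + d) ≡ α
            sc+d≡α = trans (s-palindrome (suc N) (c + d) (n * c + π) reflect)
                       (α-at periodic n (subst (n * c + π <_) (sym LN≡) (+-monoˡ-< π (m<n+m (n * c) z<s))))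
              where
                shuffle : ∀ c d x π → c + d + (x + π) ≡ c + x + π + d
                shuffle = solve-∀
                reflect : suc (c + d + (n * c + π)) ≡ L (suc N)
                reflect = trans (cong suc (trans (shuffle c d (n * c) π) (cong (_+ d) (sym LN≡)))) LN+d

    -- if d = K, both u m and u m · Δ N are palindromes read from position K, so u m is constant
    d≢K : 2 ≤ m → Δ 0 ≢ Δ 1 → d ≢ K
    d≢K 2≤m Δ0≢Δ1 d≡K = Δ0≢Δ1 (begin
      Δ 0      ≡⟨ trans (sym (s-L≡Δ 0)) (cong s L₀≡0) ⟩
      s 0      ≡⟨ on-u 0 0<π ⟩
      g 0      ≡⟨ nested-palindromes-constant inner outer (L 1) (<⇒≤ L1<π) ⟨
      g (L 1)  ≡⟨ on-u (L 1) L1<π ⟨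
      s (L 1)  ≡⟨ s-L≡Δ 1 ⟩
      Δ 1      ∎)
      where
        open ≡-Reasoning

        g : Stream (Fin k)
        g t = s (K + t)

        L1<π : L 1 < π
        L1<π = <-≤-trans (L<L-suc 1) (L-mono 2≤m)

        0<π : 0 < π
        0<π = ≤-<-trans z≤n L1<π

        on-u : ∀ t → t < π → s t ≡ g t
        on-u t t<π = sym (shift periodic (suc n) t (subst (K + t <_) (sym LN≡) (+-monoʳ-< K t<π)))

        inner : PalindromeBelow π g
        inner i j e = trans (sym (on-u i (subst (i <_) e (s≤s (m≤m+n i j)))))
                        (trans (s-palindrome m i j e) (on-u j (subst (j <_) e (s≤s (m≤n+m j i)))))

        outer : PalindromeBelow (suc π) g
        outer i j e = s-palindrome (suc N) (K + i) (K + j) (begin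
          suc (K + i + (K + j))  ≡⟨ cong suc (shuffle K i j) ⟩
          suc (K + (i + j) + K)  ≡⟨ cong (λ x → suc (K + x + K)) (suc-injective e) ⟩
          suc (K + π + K)        ≡⟨ cong₂ (λ x y → suc (x + y)) (sym LN≡) (sym d≡K) ⟩
          suc (L N + d)          ≡⟨ LN+d ⟩
          L (suc N)              ∎)
          where
            shuffle : ∀ K i j → K + i + (K + j) ≡ K + (i + j) + K
            shuffle = solve-∀

    K<d-⊥ : Δ N ≢ α → K < d → ⊥
    K<d-⊥ ΔN≢α K<d = reflection-⊥ N d (subst (π ≤_) (sym LN≡) (m≤n+m π K)) LN+d
                       (subst (_< d + π) (sym LN≡) (+-monoˡ-< π K<d)) ΔN≢α

  run-end-⊥ : ∀ n → (∀ i → i < n → Δ (i + m) ≡ α) → Δ (n + m) ≢ α → 2 ≤ m → Δ 0 ≢ Δ 1 → ⊥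
  run-end-⊥ zero    _   Δn≢α _   _     = Δn≢α Δm≡α
  run-end-⊥ (suc n) Δ≡α Δn≢α 2≤m Δ0≢Δ1 with m≤n⇒m<n∨m≡n (K≤d Δn≢α)
    where open RunEnd n Δ≡α
  ... | inj₁ K<d = RunEnd.K<d-⊥ n Δ≡α Δn≢α K<d
  ... | inj₂ K≡d = RunEnd.d≢K n Δ≡α 2≤m Δ0≢Δ1 (sym K≡d)

module FirstRepetition {k : ℕ} {s Δ : Stream (Fin k)} (bal : Balanced s) (dir : IsDirectiveSeq Δ s)
  {x : List (Fin k)} {α : Fin k} {ℓ : ℕ} (2≤ℓ : 2 ≤ ℓ) {y : Stream (Fin k)}
  (Δ≡ : ∀ n → Δ n ≡ ((x ++ replicate ℓ α) ⊙ y) n) (x-α-unique : Unique (x ++ [ α ])) where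

  open DirectiveSequence dir

  m : ℕ
  m = length x

  Δ-x : ∀ r → r < m → Δ r ∈ x
  Δ-x r r<m = subst (_∈ x) (sym (trans (Δ≡ r) (⊙-++ x _ y r))) (⊙-∈ x _ r<m)

  Δ-after-x : ∀ t → Δ (t + m) ≡ (replicate ℓ α ⊙ y) t
  Δ-after-x t = begin
    Δ (t + m)                               ≡⟨ Δ≡ (t + m) ⟩
    ((x ++ replicate ℓ α) ⊙ y) (t + m)      ≡⟨ ⊙-++ x _ y (t + m) ⟩
    (x ⊙ (replicate ℓ α ⊙ y)) (t + m)       ≡⟨ cong (x ⊙ _) (+-comm t m) ⟩
    (x ⊙ (replicate ℓ α ⊙ y)) (m + t)       ≡⟨ ⊙-length-+ x _ t ⟩
    (replicate ℓ α ⊙ y) t                   ∎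
    where open ≡-Reasoning

  Δ-α : ∀ i → i < ℓ → Δ (i + m) ≡ α
  Δ-α i i<ℓ = trans (Δ-after-x i) (replicate-⊙ ℓ α y i<ℓ)

  Δ-y : ∀ j → Δ ((ℓ + j) + m) ≡ y j
  Δ-y j = trans (Δ-after-x (ℓ + j))
            (trans (cong (λ l → (replicate ℓ α ⊙ y) (l + j)) (sym (length-replicate ℓ)))
                   (⊙-length-+ (replicate ℓ α) y j))

  α∉u : ∀ t → t < L m → s t ≢ α
  α∉u t t<π st≡α with s-from-Δ m t t<π
  ... | r , r<m , st≡Δr = unique-snoc-∉ x-α-unique (Δ-x r r<m) (trans (sym st≡Δr) st≡α)

  open BalancedSquare dir bal m α∉u (Δ-α 0 (≤-trans (s≤s z≤n) 2≤ℓ)) (Δ-α 1 2≤ℓ)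

  singleton-⊥ : AtLeastThreeLetters s → m ≡ 1 → ⊥
  singleton-⊥ three m≡1 = new-letter-⊥ N m≤N (≤-reflexive (sym m≡1)) (proj₂ PN) fresh
    where
      P : ℕ → Set
      P r = Δ r ≢ Δ 0 × Δ r ≢ α

      some-P : ∃ P
      some-P with outside-two three (Δ 0) α
      ... | t , out with s-from-Δ (suc t) t (≤-trans (s≤s (n≤L t)) (L<L-suc t))
      ...   | r , _ , st≡Δr = r , subst (λ z → z ≢ Δ 0 × z ≢ α) st≡Δr out

      first = least (λ r → ¬? (Δ r ≟ Δ 0) ×-dec ¬? (Δ r ≟ α)) (proj₂ some-P)
      N = proj₁ first
      PN = proj₁ (proj₂ first)

      m≤N : m ≤ N
      m≤N = ≤-trans (≤-reflexive m≡1) (n≢0⇒n>0 λ N≡0 → proj₁ PN (cong Δ N≡0))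

      fresh : ∀ t → t < L N → s t ≢ Δ N
      fresh t t<LN st≡ΔN with s-from-Δ N t t<LN
      ... | r , r<N , st≡Δr =
        proj₂ (proj₂ first) r r<N (subst (λ z → z ≢ Δ 0 × z ≢ α) (trans (sym st≡ΔN) st≡Δr) PN)

  y≡α : 2 ≤ m → Δ 0 ≢ Δ 1 → ∀ j → y j ≡ α
  y≡α 2≤m Δ0≢Δ1 j = decidable-stable (y j ≟ α) (λ yj≢α → run-break (least (λ i → ¬? (y i ≟ α)) yj≢α))
    where
      run-break : (∃ λ j₀ → y j₀ ≢ α × (∀ i → i < j₀ → ¬ y i ≢ α)) → ⊥
      run-break (j₀ , yj₀≢α , before) = run-end-⊥ (ℓ + j₀) run (yj₀≢α ∘ trans (sym (Δ-y j₀))) 2≤m Δ0≢Δ1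
        where
          run : ∀ i → i < ℓ + j₀ → Δ (i + m) ≡ α
          run i i<ℓ+j₀ with i <? ℓ
          ... | yes i<ℓ = Δ-α i i<ℓ
          ... | no i≮ℓ with m≤n⇒∃[o]m+o≡n (≮⇒≥ i≮ℓ)
          ...   | j′ , refl = trans (Δ-y j′) (decidable-stable (y j′ ≟ α) (before j′ (+-cancelˡ-< ℓ j′ j₀ i<ℓ+j₀)))

lemma3p4 : (k : ℕ) (s Δ : Stream (Fin k)) →
    Balanced s → AtLeastThreeLetters s → IsDirectiveSeq Δ s →
    (x : List (Fin k)) → x ≢ [] → (α : Fin k) (ℓ : ℕ) → 2 ≤ ℓ → (y : Stream (Fin k)) →
    (∀ n → Δ n ≡ ((x ++ replicate ℓ α) ⊙ y) n) →
    Unique (x ++ [ α ]) →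
    ∀ (a : Fin k) → a ∈ x → ∀ (j : ℕ) → y j ≢ a
lemma3p4 k s Δ bal three dir [] _ α ℓ 2≤ℓ y Δ≡ uniq a () j
lemma3p4 k s Δ bal three dir (_ ∷ []) _ α ℓ 2≤ℓ y Δ≡ uniq a a∈x j _ =
  FirstRepetition.singleton-⊥ bal dir 2≤ℓ Δ≡ uniq three refl
lemma3p4 k s Δ bal three dir (x₀ ∷ x₁ ∷ _) _ α ℓ 2≤ℓ y Δ≡ uniq@((x₀≢x₁ All.∷ _) ∷ _) a a∈x j yj≡a =
  unique-snoc-∉ uniq a∈x (trans (sym yj≡a) (FirstRepetition.y≡α bal dir 2≤ℓ Δ≡ uniq (s≤s (s≤s z≤n)) Δ₀≢Δ₁ j))
  where
    Δ₀≢Δ₁ : Δ 0 ≢ Δ 1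
    Δ₀≢Δ₁ Δ₀≡Δ₁ = x₀≢x₁ (trans (sym (Δ≡ 0)) (trans Δ₀≡Δ₁ (Δ≡ 1)))
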